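{- Let $m$ be odd and let $C$ be a Hamilton cycle of the grid graph $G(m,n)$. Then every row contains at least two turns of $C$.
   Context: $G(m,n)$ is the graph on cells $\{1,\dots,m\}\times\{1,\dots,n\}$ with $(a,b),(c,d)$ adjacent iff $|a-c|+|b-d|=1$. A row is the set of $m$ cells with a fixed second coordinate. A Hamilton cycle is a cycle through every cell. A turn of a cycle is a cell of the cycle whose two incident cycle edges are one horizontal and one vertical. -}

module Defs where

open import Data.Nat using (ℕ; zero; suc; _+_; _*_; _≤_; ∣_-_∣; _%_)
open import Data.Nat.DivMod using (m%n<n)
open import Data.Fin using (Fin; toℕ; fromℕ<)
open import Data.Product using (_×_; _,_; ∃; proj₁; proj₂)
open import Data.Sum using (_⊎_)
open import Relation.Binary.PropositionalEquality using (_≡_; _≢_)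
open import Function.Bundles using (_⤖_; Bijection)

Odd : ℕ → Set
Odd m = ∃ λ k → m ≡ 1 + 2 * k

-- Cells of G(m,n): (a , b) with a ∈ {1..m} (coordinate 0..m-1), b ∈ {1..n}
Cell : ℕ → ℕ → Set
Cell m n = Fin m × Fin n

Adj : ∀ {m n} → Cell m n → Cell m n → Set
Adj (a , b) (c , d) = ∣ toℕ a - toℕ c ∣ + ∣ toℕ b - toℕ d ∣ ≡ 1

-- an edge is horizontal if it stays in one row (same second coordinate),
-- vertical if it stays in one column (same first coordinate)
Horizontal : ∀ {m n} → Cell m n → Cell m n → Set
Horizontal x y = proj₂ x ≡ proj₂ y

Vertical : ∀ {m n} → Cell m n → Cell m n → Set
Vertical x y = proj₁ x ≡ proj₁ y

next : ∀ {k} → Fin (suc k) → Fin (suc k)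
next {k} i = fromℕ< (m%n<n (suc (toℕ i)) (suc k))

prev : ∀ {k} → Fin (suc k) → Fin (suc k)
prev {k} i = fromℕ< (m%n<n (toℕ i + k) (suc k))

record HamiltonCycle (m n : ℕ) : Set where
  field
    len-1  : ℕ
    enum   : Fin (suc len-1) ⤖ Cell m n
  L : ℕ
  L = suc len-1
  v : Fin L → Cell m n
  v = Bijection.to enum
  field
    len≥3  : 3 ≤ L
    adj    : ∀ i → Adj (v i) (v (next i))

open HamiltonCycle public

IsTurn : ∀ {m n} (C : HamiltonCycle m n) → Fin (L C) → Set
IsTurn C i =
  (Horizontal (v C (prev i)) (v C i) × Vertical (v C i) (v C (next i)))
  ⊎ (Vertical (v C (prev i)) (v C i) × Horizontal (v C i) (v C (next i)))

InRow : ∀ {m n} (C : HamiltonCycle m n) → Fin n → Fin (L C) → Set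
InRow C b i = proj₂ (v C i) ≡ b

-- Along the cycle, each cell of row b has 0, 1 or 2 horizontal edges, and summing over the row
-- counts every horizontal edge inside the row twice; the cells with exactly one are the turns, so
-- the row has an even number of turns. If it had none, a horizontal edge in the row would extend
-- straight on forever, so every cell of the row is passed vertically and has exactly one cycle
-- edge to row b + 1. Then the cycle crosses between rows b and b + 1 exactly m times, which is
-- odd, while a closed walk crosses every cut an even number of times.

module Submission where

open import Defs
open import Data.Bool.Base using (Bool; true; false; T; _∧_; _xor_)
open import Data.Bool.Properties using (∧-zeroʳ)
open import Data.Empty using (⊥-elim)
open import Data.Fin using (Fin; zero; suc; toℕ; _↑ˡ_; _↑ʳ_; remQuot; combine)
import Data.Fin.Properties as Fin
open import Data.Fin.Permutation using (Permutation; permutation; flip; _⟨$⟩ʳ_)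
open import Data.Nat
  using (ℕ; zero; suc; _+_; _*_; _≤_; _<_; s≤s; s≤s⁻¹; ∣_-_∣; _%_; _/_; _≡ᵇ_; _<ᵇ_; NonZero; ≢-nonZero)
open import Data.Nat.DivMod using (m≡m%n+[m/n]*n; m%n%n≡m%n; %-distribˡ-+; [m+n]%n≡m%n; m<n⇒m%n≡m)
open import Data.Nat.Divisibility using (_∣_; ∣m+n∣m⇒∣n; m∣m*n; ∣1⇒≡1; ∣⇒≤)
open import Data.Nat.Properties
open import Algebra.Properties.Semiring.Sum +-*-semiring
  using (sum; sum-cong-≗; ∑-distrib-+; sum-permute; *-distribˡ-sum)
open import Data.Product using (Σ; ∃₂; _×_; _,_; proj₁; proj₂)
open import Data.Sum using (_⊎_; inj₁; inj₂; [_,_]′)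
import Data.Sum as Sum
open import Function.Base using (_∘_)
open import Function.Bundles using (_⤖_; Bijection)
open import Function.Properties.Bijection using (⤖⇒↔)
open import Function.Properties.Inverse using (↔-trans; ↔-sym)
open import Relation.Nullary using (¬_)
open import Relation.Binary.PropositionalEquality
  using (_≡_; _≢_; refl; sym; trans; cong; cong₂; subst; module ≡-Reasoning)

⟦_⟧ : Bool → ℕ
⟦ false ⟧ = 0
⟦ true ⟧ = 1

⟦∧⟧+⟦∧⟧ : ∀ r a c → ⟦ r ∧ a ⟧ + ⟦ r ∧ c ⟧ ≡ ⟦ r ∧ (a xor c) ⟧ + 2 * ⟦ r ∧ (a ∧ c) ⟧
⟦∧⟧+⟦∧⟧ false a     c     = refl
⟦∧⟧+⟦∧⟧ true  false false = refl
⟦∧⟧+⟦∧⟧ true  false true  = refl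
⟦∧⟧+⟦∧⟧ true  true  false = refl
⟦∧⟧+⟦∧⟧ true  true  true  = refl

∧xor≡true : ∀ r a c → r ∧ (a xor c) ≡ true →
  r ≡ true × (a ≡ true × c ≡ false ⊎ a ≡ false × c ≡ true)
∧xor≡true true true  false _ = refl , inj₁ (refl , refl)
∧xor≡true true false true  _ = refl , inj₂ (refl , refl)

xor≡false⇒≡ : ∀ a c → a xor c ≡ false → a ≡ c
xor≡false⇒≡ false false _ = refl
xor≡false⇒≡ true  true  _ = refl

≡ᵇ-true⇒≡ : ∀ x y → (x ≡ᵇ y) ≡ true → x ≡ y
≡ᵇ-true⇒≡ x y e = ≡ᵇ⇒≡ x y (subst T (sym e) _)

≡ᵇ-false⇒≢ : ∀ x y → (x ≡ᵇ y) ≡ false → x ≢ y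
≡ᵇ-false⇒≢ x _ e refl = subst T e (≡⇒≡ᵇ x x refl)

<ᵇ-suc : ∀ x → (x <ᵇ suc x) ≡ true
<ᵇ-suc zero    = refl
<ᵇ-suc (suc x) = <ᵇ-suc x

suc-≮ᵇ : ∀ x → (suc x <ᵇ x) ≡ false
suc-≮ᵇ zero    = refl
suc-≮ᵇ (suc x) = suc-≮ᵇ x

count : ∀ {k} → (Fin k → Bool) → ℕ
count p = sum (λ i → ⟦ p i ⟧)

count≡0⇒false : ∀ {k} (p : Fin k → Bool) → count p ≡ 0 → ∀ i → p i ≡ false
count≡0⇒false p h zero with p zero
... | false = refl
count≡0⇒false p h (suc i) with p zero
... | false = count≡0⇒false (p ∘ suc) h i

1≤count⇒true : ∀ {k} (p : Fin k → Bool) → 1 ≤ count p → Σ (Fin k) λ i → p i ≡ true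
1≤count⇒true {suc k} p h with p zero in e
... | true  = zero , e
... | false = let i , pi = 1≤count⇒true (p ∘ suc) h in suc i , pi

2≤count⇒two-trues : ∀ {k} (p : Fin k → Bool) → 2 ≤ count p →
  ∃₂ λ i j → i ≢ j × p i ≡ true × p j ≡ true
2≤count⇒two-trues {suc k} p h with p zero in e
... | true  = let j , pj = 1≤count⇒true (p ∘ suc) (s≤s⁻¹ h) in zero , suc j , (λ ()) , e , pj
... | false = let i , j , i≢j , pi , pj = 2≤count⇒two-trues (p ∘ suc) h
              in suc i , suc j , i≢j ∘ Fin.suc-injective , pi , pj

2∣-cancel : ∀ a p q → a + 2 * p ≡ 2 * q → 2 ∣ a
2∣-cancel a p q e =
  ∣m+n∣m⇒∣n (subst (2 ∣_) (trans (sym e) (+-comm a (2 * p))) (m∣m*n q)) (m∣m*n p)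

odd⇒2∤ : ∀ {m} → Odd m → ¬ 2 ∣ m
odd⇒2∤ (k , refl) 2∣m with ∣1⇒≡1 (∣m+n∣m⇒∣n (subst (2 ∣_) (+-comm 1 (2 * k)) 2∣m) (m∣m*n k))
... | ()

count-∧xor-even : ∀ {k} (r a c : Fin k → Bool) →
  count (λ i → r i ∧ a i) ≡ count (λ i → r i ∧ c i) →
  2 ∣ count (λ i → r i ∧ (a i xor c i))
count-∧xor-even {k} r a c same = 2∣-cancel _ (count both) (count (λ i → r i ∧ c i)) (begin
  count differ + 2 * count both
    ≡⟨ cong (count differ +_) (*-distribˡ-sum 2 (λ i → ⟦ both i ⟧)) ⟩
  count differ + sum (λ i → 2 * ⟦ both i ⟧)
    ≡⟨ ∑-distrib-+ (λ i → ⟦ differ i ⟧) (λ i → 2 * ⟦ both i ⟧) ⟨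
  sum (λ i → ⟦ differ i ⟧ + 2 * ⟦ both i ⟧)
    ≡⟨ sum-cong-≗ (λ i → ⟦∧⟧+⟦∧⟧ (r i) (a i) (c i)) ⟨
  sum (λ i → ⟦ r i ∧ a i ⟧ + ⟦ r i ∧ c i ⟧)
    ≡⟨ ∑-distrib-+ (λ i → ⟦ r i ∧ a i ⟧) (λ i → ⟦ r i ∧ c i ⟧) ⟩
  count (λ i → r i ∧ a i) + count (λ i → r i ∧ c i)
    ≡⟨ cong (_+ count (λ i → r i ∧ c i)) same ⟩
  count (λ i → r i ∧ c i) + count (λ i → r i ∧ c i)
    ≡⟨ cong (count (λ i → r i ∧ c i) +_) (+-identityʳ _) ⟨
  2 * count (λ i → r i ∧ c i) ∎)
  where
  open ≡-Reasoning
  differ both : Fin k → Bool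
  differ i = r i ∧ (a i xor c i)
  both   i = r i ∧ (a i ∧ c i)

[m+n%d]%d≡[m+n]%d : ∀ m n d .{{_ : NonZero d}} → (m + n % d) % d ≡ (m + n) % d
[m+n%d]%d≡[m+n]%d m n d = begin
  (m + n % d) % d         ≡⟨ %-distribˡ-+ m (n % d) d ⟩
  (m % d + n % d % d) % d ≡⟨ cong (λ t → (m % d + t) % d) (m%n%n≡m%n n d) ⟩
  (m % d + n % d) % d     ≡⟨ %-distribˡ-+ m n d ⟨
  (m + n) % d             ∎
  where open ≡-Reasoning

[2+m]%n≢m : ∀ m n .{{_ : NonZero n}} → 3 ≤ n → (2 + m) % n ≢ m
[2+m]%n≢m m n 3≤n e = q*n≢2 ((2 + m) / n) (sym (+-cancelˡ-≡ m 2 _ (begin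
  m + 2                         ≡⟨ +-comm m 2 ⟩
  2 + m                         ≡⟨ m≡m%n+[m/n]*n (2 + m) n ⟩
  (2 + m) % n + (2 + m) / n * n ≡⟨ cong (_+ (2 + m) / n * n) e ⟩
  m + (2 + m) / n * n           ∎)))
  where
  open ≡-Reasoning
  q*n≢2 : ∀ q → q * n ≢ 2
  q*n≢2 zero    ()
  q*n≢2 (suc q) q*n≡2 = <⇒≱ (≤-trans 3≤n (m≤m+n n (q * n))) (≤-reflexive q*n≡2)

toℕ-next : ∀ {k} (i : Fin (suc k)) → toℕ (next i) ≡ suc (toℕ i) % suc k
toℕ-next i = Fin.toℕ-fromℕ< _

toℕ-prev : ∀ {k} (i : Fin (suc k)) → toℕ (prev i) ≡ (toℕ i + k) % suc k
toℕ-prev i = Fin.toℕ-fromℕ< _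

[toℕ+n]%n≡toℕ : ∀ {n} (i : Fin (suc n)) → (toℕ i + suc n) % suc n ≡ toℕ i
[toℕ+n]%n≡toℕ {n} i = trans ([m+n]%n≡m%n (toℕ i) (suc n)) (m<n⇒m%n≡m (Fin.toℕ<n i))

next-prev : ∀ {k} (i : Fin (suc k)) → next (prev i) ≡ i
next-prev {k} i = Fin.toℕ-injective (begin
  toℕ (next (prev i))              ≡⟨ toℕ-next (prev i) ⟩
  (1 + toℕ (prev i)) % suc k       ≡⟨ cong (λ t → (1 + t) % suc k) (toℕ-prev i) ⟩
  (1 + (toℕ i + k) % suc k) % suc k ≡⟨ [m+n%d]%d≡[m+n]%d 1 (toℕ i + k) (suc k) ⟩
  suc (toℕ i + k) % suc k          ≡⟨ cong (_% suc k) (+-suc (toℕ i) k) ⟨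
  (toℕ i + suc k) % suc k          ≡⟨ [toℕ+n]%n≡toℕ i ⟩
  toℕ i                            ∎)
  where open ≡-Reasoning

prev-next : ∀ {k} (i : Fin (suc k)) → prev (next i) ≡ i
prev-next {k} i = Fin.toℕ-injective (begin
  toℕ (prev (next i))               ≡⟨ toℕ-prev (next i) ⟩
  (toℕ (next i) + k) % suc k        ≡⟨ cong (λ t → (t + k) % suc k) (toℕ-next i) ⟩
  (suc (toℕ i) % suc k + k) % suc k ≡⟨ cong (_% suc k) (+-comm _ k) ⟩
  (k + suc (toℕ i) % suc k) % suc k ≡⟨ [m+n%d]%d≡[m+n]%d k (suc (toℕ i)) (suc k) ⟩
  (k + suc (toℕ i)) % suc k         ≡⟨ cong (_% suc k) (+-comm k (suc (toℕ i))) ⟩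
  (suc (toℕ i) + k) % suc k         ≡⟨ cong (_% suc k) (+-suc (toℕ i) k) ⟨
  (toℕ i + suc k) % suc k           ≡⟨ [toℕ+n]%n≡toℕ i ⟩
  toℕ i                             ∎)
  where open ≡-Reasoning

rotation : ∀ {k} → Permutation (suc k) (suc k)
rotation = permutation next prev next-prev prev-next

sum-next : ∀ {k} (f : Fin (suc k) → ℕ) → sum f ≡ sum (f ∘ next)
sum-next f = sum-permute f rotation

sum-prev : ∀ {k} (f : Fin (suc k) → ℕ) → sum f ≡ sum (f ∘ prev)
sum-prev f = sum-permute f (flip rotation)

prev≢next : ∀ {k} → 3 ≤ suc k → (i : Fin (suc k)) → prev i ≢ next i
prev≢next {k} 3≤k+1 i e = [2+m]%n≢m (toℕ i) (suc k) 3≤k+1 (sym (begin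
  toℕ i                           ≡⟨ cong toℕ (trans (sym (next-prev i)) (cong next e)) ⟩
  toℕ (next (next i))             ≡⟨ toℕ-next (next i) ⟩
  (1 + toℕ (next i)) % suc k      ≡⟨ cong (λ t → (1 + t) % suc k) (toℕ-next i) ⟩
  (1 + suc (toℕ i) % suc k) % suc k ≡⟨ [m+n%d]%d≡[m+n]%d 1 (suc (toℕ i)) (suc k) ⟩
  (2 + toℕ i) % suc k             ∎))
  where open ≡-Reasoning

changes-even : ∀ {k} (g : Fin (suc k) → Bool) → 2 ∣ count (λ i → g i xor g (next i))
changes-even g = count-∧xor-even (λ _ → true) g (g ∘ next) (sum-next (λ i → ⟦ g i ⟧))

sum-splitAt : ∀ a c (f : Fin (a + c) → ℕ) → sum f ≡ sum (f ∘ (_↑ˡ c)) + sum (f ∘ (a ↑ʳ_))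
sum-splitAt zero    c f = refl
sum-splitAt (suc a) c f =
  trans (cong (f zero +_) (sum-splitAt a c (f ∘ suc))) (sym (+-assoc (f zero) _ _))

sum-remQuot : ∀ m {n} (F : Fin m × Fin n → ℕ) →
  sum (F ∘ remQuot {m} n) ≡ sum (λ a → sum (λ c → F (a , c)))
sum-remQuot zero    F = refl
sum-remQuot (suc m) {n} F = begin
  sum (F ∘ remQuot {suc m} n)
    ≡⟨ sum-splitAt n (m * n) _ ⟩
  sum (λ c → F (remQuot {suc m} n (c ↑ˡ m * n))) + sum (λ j → F (remQuot {suc m} n (n ↑ʳ j)))
    ≡⟨ cong₂ _+_ (sum-cong-≗ (λ c → cong F (Fin.remQuot-combine {suc m} zero c)))
                 (sum-cong-≗ (λ j → cong F (remQuot-↑ʳ j))) ⟩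
  sum (λ c → F (zero , c)) + sum (λ j → F (suc (proj₁ (remQuot {m} n j)) , proj₂ (remQuot {m} n j)))
    ≡⟨ cong (sum (λ c → F (zero , c)) +_) (sum-remQuot m (λ (a , c) → F (suc a , c))) ⟩
  sum (λ a → sum (λ c → F (a , c))) ∎
  where
  open ≡-Reasoning
  remQuot-↑ʳ : ∀ j → remQuot {suc m} n (n ↑ʳ j) ≡ (suc (proj₁ (remQuot {m} n j)) , proj₂ (remQuot {m} n j))
  remQuot-↑ʳ j rewrite Fin.splitAt-↑ʳ n (m * n) j = refl

sum-⤖-× : ∀ {k m n} (e : Fin k ⤖ (Fin m × Fin n)) (F : Fin m × Fin n → ℕ) →
  sum (F ∘ Bijection.to e) ≡ sum (λ a → sum (λ c → F (a , c)))
sum-⤖-× {k} {m} {n} e F = begin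
  sum (F ∘ Bijection.to e)
    ≡⟨ sum-cong-≗ (λ i → cong F (sym (uncurry-remQuot-combine (Bijection.to e i)))) ⟩
  sum (λ i → F (remQuot {m} n (π ⟨$⟩ʳ i)))
    ≡⟨ sum-permute (F ∘ remQuot {m} n) π ⟨
  sum (F ∘ remQuot {m} n)
    ≡⟨ sum-remQuot m F ⟩
  sum (λ a → sum (λ c → F (a , c))) ∎
  where
  open ≡-Reasoning
  π : Permutation k (m * n)
  π = ↔-trans (⤖⇒↔ e) (↔-sym (Fin.*↔× {m} {n}))
  uncurry-remQuot-combine : ∀ ((a , c) : Fin m × Fin n) → remQuot {m} n (combine a c) ≡ (a , c)
  uncurry-remQuot-combine (a , c) = Fin.remQuot-combine a c

sum-const-1 : ∀ m → sum {m} (λ _ → 1) ≡ m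
sum-const-1 zero    = refl
sum-const-1 (suc m) = cong suc (sum-const-1 m)

count-≡ᵇ : ∀ {n} (b : Fin n) → count {n} (λ c → toℕ c ≡ᵇ toℕ b) ≡ 1
count-≡ᵇ {suc n} zero    = cong suc (count≡0 {n})
  where
  count≡0 : ∀ {n} → count {n} (λ c → suc (toℕ c) ≡ᵇ 0) ≡ 0
  count≡0 {zero}  = refl
  count≡0 {suc n} = count≡0 {n}
count-≡ᵇ {suc n} (suc b) = count-≡ᵇ b

-- An edge between rows x and y at distance at most 1 changes side of the cut between rows r and
-- r + 1 exactly when it joins those two rows.
crossing : ∀ r x y → ∣ x - y ∣ ≤ 1 →
  ⟦ (x ≡ᵇ r) ∧ (r <ᵇ y) ⟧ + ⟦ (r <ᵇ x) ∧ (y ≡ᵇ r) ⟧ ≡ ⟦ (r <ᵇ x) xor (r <ᵇ y) ⟧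
crossing zero          zero          zero          _ = refl
crossing zero          zero          (suc zero)    _ = refl
crossing zero          (suc x)       zero          _ = refl
crossing zero          (suc x)       (suc y)       _ = refl
crossing (suc r)       zero          zero          _ = refl
crossing (suc r)       zero          (suc zero)    _ = refl
crossing (suc zero)    (suc zero)    zero          _ = refl
crossing (suc (suc r)) (suc zero)    zero          _ = refl
crossing (suc r)       (suc x)       (suc y)       h = crossing r x y h
crossing zero          zero          (suc (suc y)) (s≤s ())
crossing (suc r)       zero          (suc (suc y)) (s≤s ())
crossing (suc r)       (suc (suc x)) zero          (s≤s ())

m+n≡1⇒m≡1⊎n≡1 : ∀ p q → p + q ≡ 1 → p ≡ 1 × q ≡ 0 ⊎ p ≡ 0 × q ≡ 1
m+n≡1⇒m≡1⊎n≡1 zero       (suc zero) _ = inj₂ (refl , refl)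
m+n≡1⇒m≡1⊎n≡1 (suc zero) zero       _ = inj₁ (refl , refl)

∣m-n∣≡1⇒1+m≡n⊎m≡1+n : ∀ x y → ∣ x - y ∣ ≡ 1 → suc x ≡ y ⊎ x ≡ suc y
∣m-n∣≡1⇒1+m≡n⊎m≡1+n zero          (suc zero) _ = inj₁ refl
∣m-n∣≡1⇒1+m≡n⊎m≡1+n (suc zero)    zero       _ = inj₂ refl
∣m-n∣≡1⇒1+m≡n⊎m≡1+n (suc x)       (suc y)    e = Sum.map (cong suc) (cong suc) (∣m-n∣≡1⇒1+m≡n⊎m≡1+n x y e)

neighbours-opposite : ∀ {x c y} → ∣ x - c ∣ ≡ 1 → ∣ c - y ∣ ≡ 1 → x ≢ y →
  suc x ≡ c × y ≡ suc c ⊎ x ≡ suc c × suc y ≡ c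
neighbours-opposite {x} {c} {y} xc cy x≢y
  with ∣m-n∣≡1⇒1+m≡n⊎m≡1+n x c xc | ∣m-n∣≡1⇒1+m≡n⊎m≡1+n y c (trans (∣-∣-comm y c) cy)
... | inj₁ x<c | inj₁ y<c = ⊥-elim (x≢y (suc-injective (trans x<c (sym y<c))))
... | inj₁ x<c | inj₂ y>c = inj₁ (x<c , y>c)
... | inj₂ x>c | inj₁ y<c = inj₂ (x>c , y<c)
... | inj₂ x>c | inj₂ y>c = ⊥-elim (x≢y (trans x>c (sym y>c)))

col row : ∀ {m n} → Cell m n → ℕ
col = toℕ ∘ proj₁
row = toℕ ∘ proj₂

Adj-horizontal : ∀ {m n} (x y : Cell m n) → Adj x y → Horizontal x y → ∣ col x - col y ∣ ≡ 1
Adj-horizontal x y xy h =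
  trans (sym (+-identityʳ _)) (subst (λ d → ∣ col x - col y ∣ + d ≡ 1) (m≡n⇒∣m-n∣≡0 (cong toℕ h)) xy)

Adj-vertical : ∀ {m n} (x y : Cell m n) → Adj x y → ¬ Horizontal x y →
  Vertical x y × ∣ row x - row y ∣ ≡ 1
Adj-vertical x y xy ¬h with m+n≡1⇒m≡1⊎n≡1 _ _ xy
... | inj₁ (_ , rows≡) = ⊥-elim (¬h (Fin.toℕ-injective (∣m-n∣≡0⇒m≡n rows≡)))
... | inj₂ (cols≡ , ∣rows∣≡1) = Fin.toℕ-injective (∣m-n∣≡0⇒m≡n cols≡) , ∣rows∣≡1

Adj⇒∣row-row∣≤1 : ∀ {m n} (x y : Cell m n) → Adj x y → ∣ row x - row y ∣ ≤ 1
Adj⇒∣row-row∣≤1 x y xy = subst (∣ row x - row y ∣ ≤_) xy (m≤n+m _ _)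

module RowTurns {m n : ℕ} (C : HamiltonCycle m n) (b : Fin n) where

  r : ℕ
  r = toℕ b

  rowAt colAt : Fin (L C) → ℕ
  rowAt = row ∘ v C
  colAt = col ∘ v C

  inRowᵇ horizontalᵇ aboveᵇ turnᵇ : Fin (L C) → Bool
  inRowᵇ i      = rowAt i ≡ᵇ r
  horizontalᵇ i = rowAt i ≡ᵇ rowAt (next i)
  aboveᵇ i      = r <ᵇ rowAt i
  turnᵇ i       = inRowᵇ i ∧ (horizontalᵇ (prev i) xor horizontalᵇ i)

  adj-prev : ∀ i → Adj (v C (prev i)) (v C i)
  adj-prev i = subst (Adj (v C (prev i)) ∘ v C) (next-prev i) (adj C (prev i))

  prev≢next-cell : ∀ i → v C (prev i) ≢ v C (next i)
  prev≢next-cell i = prev≢next (len≥3 C) i ∘ Bijection.injective (enum C)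

  horizontal-out : ∀ i → horizontalᵇ i ≡ true → Horizontal (v C i) (v C (next i))
  horizontal-out i h = Fin.toℕ-injective (≡ᵇ-true⇒≡ (rowAt i) (rowAt (next i)) h)

  horizontal-in : ∀ i → horizontalᵇ (prev i) ≡ true → Horizontal (v C (prev i)) (v C i)
  horizontal-in i h = subst (Horizontal (v C (prev i)) ∘ v C) (next-prev i) (horizontal-out (prev i) h)

  vertical-out : ∀ i → horizontalᵇ i ≡ false →
    Vertical (v C i) (v C (next i)) × ∣ rowAt i - rowAt (next i) ∣ ≡ 1
  vertical-out i h = Adj-vertical (v C i) (v C (next i)) (adj C i) (≡ᵇ-false⇒≢ (rowAt i) (rowAt (next i)) h ∘ cong toℕ)

  vertical-in : ∀ i → horizontalᵇ (prev i) ≡ false →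
    Vertical (v C (prev i)) (v C i) × ∣ rowAt (prev i) - rowAt i ∣ ≡ 1
  vertical-in i h = subst (λ j → Vertical (v C (prev i)) (v C j) × ∣ rowAt (prev i) - rowAt j ∣ ≡ 1)
    (next-prev i) (vertical-out (prev i) h)

  inRowᵇ-next : ∀ i → horizontalᵇ i ≡ true → inRowᵇ (next i) ≡ inRowᵇ i
  inRowᵇ-next i h = cong (_≡ᵇ r) (sym (≡ᵇ-true⇒≡ (rowAt i) (rowAt (next i)) h))

  straight-horizontally : ∀ i → horizontalᵇ (prev i) ≡ true → horizontalᵇ i ≡ true →
    suc (colAt (prev i)) ≡ colAt i × colAt (next i) ≡ suc (colAt i) ⊎
    colAt (prev i) ≡ suc (colAt i) × suc (colAt (next i)) ≡ colAt i
  straight-horizontally i hp hn =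
    neighbours-opposite (Adj-horizontal (v C (prev i)) (v C i) (adj-prev i) (horizontal-in i hp))
                        (Adj-horizontal (v C i) (v C (next i)) (adj C i) (horizontal-out i hn))
      λ cols≡ → prev≢next-cell i (cong₂ _,_ (Fin.toℕ-injective cols≡) (trans (horizontal-in i hp) (horizontal-out i hn)))

  straight-vertically : ∀ i → horizontalᵇ (prev i) ≡ false → horizontalᵇ i ≡ false →
    suc (rowAt (prev i)) ≡ rowAt i × rowAt (next i) ≡ suc (rowAt i) ⊎
    rowAt (prev i) ≡ suc (rowAt i) × suc (rowAt (next i)) ≡ rowAt i
  straight-vertically i hp hn =
    neighbours-opposite (proj₂ (vertical-in i hp)) (proj₂ (vertical-out i hn))
      λ rows≡ → prev≢next-cell i (cong₂ _,_ (trans (proj₁ (vertical-in i hp)) (proj₁ (vertical-out i hn))) (Fin.toℕ-injective rows≡))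

  turnᵇ-sound : ∀ i → turnᵇ i ≡ true → InRow C b i × IsTurn C i
  turnᵇ-sound i t with ∧xor≡true (inRowᵇ i) (horizontalᵇ (prev i)) (horizontalᵇ i) t
  ... | inRow , inj₁ (hp , hn) =
    Fin.toℕ-injective (≡ᵇ-true⇒≡ (rowAt i) r inRow) , inj₁ (horizontal-in i hp , proj₁ (vertical-out i hn))
  ... | inRow , inj₂ (hp , hn) =
    Fin.toℕ-injective (≡ᵇ-true⇒≡ (rowAt i) r inRow) , inj₂ (proj₁ (vertical-in i hp) , horizontal-out i hn)

  turns-even : 2 ∣ count turnᵇ
  turns-even = count-∧xor-even inRowᵇ (horizontalᵇ ∘ prev) horizontalᵇ (begin
    count (λ i → inRowᵇ i ∧ horizontalᵇ (prev i))
      ≡⟨ sum-next (λ i → ⟦ inRowᵇ i ∧ horizontalᵇ (prev i) ⟧) ⟩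
    count (λ i → inRowᵇ (next i) ∧ horizontalᵇ (prev (next i)))
      ≡⟨ sum-cong-≗ (λ i → cong (λ j → ⟦ inRowᵇ (next i) ∧ horizontalᵇ j ⟧) (prev-next i)) ⟩
    count (λ i → inRowᵇ (next i) ∧ horizontalᵇ i)
      ≡⟨ sum-cong-≗ (cong ⟦_⟧ ∘ horizontal-edge-in-row) ⟩
    count (λ i → inRowᵇ i ∧ horizontalᵇ i) ∎)
    where
    open ≡-Reasoning
    horizontal-edge-in-row : ∀ i → inRowᵇ (next i) ∧ horizontalᵇ i ≡ inRowᵇ i ∧ horizontalᵇ i
    horizontal-edge-in-row i with horizontalᵇ i in h
    ... | true  = cong (_∧ true) (inRowᵇ-next i h)
    ... | false = trans (∧-zeroʳ _) (sym (∧-zeroʳ _))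

  row-size : count inRowᵇ ≡ m
  row-size = begin
    count inRowᵇ                             ≡⟨ sum-⤖-× (enum C) (λ (_ , c) → ⟦ toℕ c ≡ᵇ r ⟧) ⟩
    sum {m} (λ _ → count {n} (λ c → toℕ c ≡ᵇ r)) ≡⟨ sum-cong-≗ {m} (λ _ → count-≡ᵇ b) ⟩
    sum {m} (λ _ → 1)                        ≡⟨ sum-const-1 m ⟩
    m                                        ∎
    where open ≡-Reasoning

  module NoTurn (no-turn : ∀ i → turnᵇ i ≡ false) where

    straight : ∀ i → inRowᵇ i ≡ true → horizontalᵇ (prev i) ≡ horizontalᵇ i
    straight i inRow = xor≡false⇒≡ _ _
      (subst (λ x → x ∧ (horizontalᵇ (prev i) xor horizontalᵇ i) ≡ false) inRow (no-turn i))

    -- Without turns a horizontal edge in the row continues straight on in both directions, so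
    -- some neighbour is again such an edge, one column further left.
    no-horizontal-left-of : ∀ c i → colAt i < c → inRowᵇ i ≡ true → horizontalᵇ i ≢ true
    no-horizontal-left-of (suc c) i (s≤s i<c) inRow hn =
      [ (λ (p<i , _) → no-horizontal-left-of c (prev i) (subst (_≤ c) (sym p<i) i<c) inRow-prev hp)
      , (λ (_ , n<i) → no-horizontal-left-of c (next i) (subst (_≤ c) (sym n<i) i<c) inRow-next hn-next)
      ]′ (straight-horizontally i hp hn)
      where
      hp : horizontalᵇ (prev i) ≡ true
      hp = trans (straight i inRow) hn
      inRow-prev : inRowᵇ (prev i) ≡ true
      inRow-prev = trans (sym (inRowᵇ-next (prev i) hp)) (trans (cong inRowᵇ (next-prev i)) inRow)
      inRow-next : inRowᵇ (next i) ≡ true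
      inRow-next = trans (inRowᵇ-next i hn) inRow
      hn-next : horizontalᵇ (next i) ≡ true
      hn-next = trans (sym (straight (next i) inRow-next)) (trans (cong horizontalᵇ (prev-next i)) hn)

    no-horizontal : ∀ i → inRowᵇ i ≡ true → horizontalᵇ i ≡ false
    no-horizontal i inRow with horizontalᵇ i in h
    ... | false = refl
    ... | true  = ⊥-elim (no-horizontal-left-of (suc (colAt i)) i ≤-refl inRow h)

    one-edge-up : ∀ i → ⟦ inRowᵇ i ∧ aboveᵇ (next i) ⟧ + ⟦ aboveᵇ (prev i) ∧ inRowᵇ i ⟧ ≡ ⟦ inRowᵇ i ⟧
    one-edge-up i with inRowᵇ i in inRow
    ... | false = cong ⟦_⟧ (∧-zeroʳ (aboveᵇ (prev i)))
    ... | true  with straight-vertically i (trans (straight i inRow) (no-horizontal i inRow)) (no-horizontal i inRow)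
    ...   | inj₁ (p<i , n>i) = cong₂ (λ a p → ⟦ a ⟧ + ⟦ p ∧ true ⟧)
              (trans (cong (r <ᵇ_) (trans n>i (cong suc i≡r))) (<ᵇ-suc r))
              (trans (cong (_<ᵇ rowAt (prev i)) (trans (sym i≡r) (sym p<i))) (suc-≮ᵇ (rowAt (prev i))))
      where
      i≡r : rowAt i ≡ r
      i≡r = ≡ᵇ-true⇒≡ (rowAt i) r inRow
    ...   | inj₂ (p>i , n<i) = cong₂ (λ a p → ⟦ a ⟧ + ⟦ p ∧ true ⟧)
              (trans (cong (_<ᵇ rowAt (next i)) (trans (sym i≡r) (sym n<i))) (suc-≮ᵇ (rowAt (next i))))
              (trans (cong (r <ᵇ_) (trans p>i (cong suc i≡r))) (<ᵇ-suc r))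
      where
      i≡r : rowAt i ≡ r
      i≡r = ≡ᵇ-true⇒≡ (rowAt i) r inRow

    crossings≡row-size : count (λ i → aboveᵇ i xor aboveᵇ (next i)) ≡ count inRowᵇ
    crossings≡row-size = begin
      count (λ i → aboveᵇ i xor aboveᵇ (next i))
        ≡⟨ sum-cong-≗ (λ i → crossing r (rowAt i) (rowAt (next i)) (Adj⇒∣row-row∣≤1 (v C i) (v C (next i)) (adj C i))) ⟨
      sum (λ i → ⟦ inRowᵇ i ∧ aboveᵇ (next i) ⟧ + ⟦ aboveᵇ i ∧ inRowᵇ (next i) ⟧)
        ≡⟨ ∑-distrib-+ (λ i → ⟦ inRowᵇ i ∧ aboveᵇ (next i) ⟧) (λ i → ⟦ aboveᵇ i ∧ inRowᵇ (next i) ⟧) ⟩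
      count up + count (λ i → aboveᵇ i ∧ inRowᵇ (next i))
        ≡⟨ cong (count up +_) (sum-prev (λ i → ⟦ aboveᵇ i ∧ inRowᵇ (next i) ⟧)) ⟩
      count up + count (λ i → aboveᵇ (prev i) ∧ inRowᵇ (next (prev i)))
        ≡⟨ cong (count up +_) (sum-cong-≗ (λ i → cong (λ j → ⟦ aboveᵇ (prev i) ∧ inRowᵇ j ⟧) (next-prev i))) ⟩
      count up + count (λ i → aboveᵇ (prev i) ∧ inRowᵇ i)
        ≡⟨ ∑-distrib-+ (λ i → ⟦ up i ⟧) (λ i → ⟦ aboveᵇ (prev i) ∧ inRowᵇ i ⟧) ⟨
      sum (λ i → ⟦ up i ⟧ + ⟦ aboveᵇ (prev i) ∧ inRowᵇ i ⟧)
        ≡⟨ sum-cong-≗ one-edge-up ⟩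
      count inRowᵇ ∎
      where
      open ≡-Reasoning
      up : Fin (L C) → Bool
      up i = inRowᵇ i ∧ aboveᵇ (next i)

  no-turns-impossible : Odd m → ¬ (∀ i → turnᵇ i ≡ false)
  no-turns-impossible odd no-turn =
    odd⇒2∤ odd (subst (2 ∣_) (trans crossings≡row-size row-size) (changes-even aboveᵇ))
    where open NoTurn no-turn

  two-turns : Odd m → 2 ≤ count turnᵇ
  two-turns odd =
    ∣⇒≤ {{≢-nonZero (no-turns-impossible odd ∘ count≡0⇒false turnᵇ)}} turns-even

corollary7 : (m n : ℕ) → Odd m → (C : HamiltonCycle m n) → (b : Fin n) →
    ∃₂ λ (i j : Fin (L C)) →
      i ≢ j × InRow C b i × InRow C b j × IsTurn C i × IsTurn C j
corollary7 m n odd C b =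
  let i , j , i≢j , turn-i , turn-j = 2≤count⇒two-trues turnᵇ (two-turns odd)
      inRow-i , isTurn-i = turnᵇ-sound i turn-i
      inRow-j , isTurn-j = turnᵇ-sound j turn-j
  in  i , j , i≢j , inRow-i , inRow-j , isTurn-i , isTurn-j
  where open RowTurns C b
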